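{- For every integer $n\ge 0$, $F_n$ and $C_{n+1}$ are $p(n)$-moves states; that is, if $n$ is even they are even-moves states and if $n$ is odd they are odd-moves states.
   Context: A decoration of a graph is a set of arrows on edges, at most one per edge; a vertex is a sink (source) if all its edges carry arrows into (out of) it; a state is a decoration with no sink or source at a vertex of degree $\ge2$. A follower of a state $X$ is a state $X\cup\{(v,w)\}$ with $\{v,w\}$ unmarked in $X$; descendents are iterated followers; a state is terminal if it has no followers. A state $X$ is an even-moves (resp. odd-moves) state if for every terminal state $X^*$ which is $X$ or a descendent of $X$, $|X^*\setminus X|$ is even (resp. odd). $F_n=\{(-1,0),(n,n+1)\}$ ($n\ge0$) and $C_n=\{(-1,0),(n+1,n)\}$ ($n\ge1$) are states of the path with vertices $-1,0,\dots,n+1$. -}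

module Defs where

import Data.Nat
open import Data.Nat using (ℕ; zero; suc; _+_; _≤_; _%_)
open import Data.Bool using (Bool; true; false; _∧_; _∨_; not; if_then_else_)
open import Data.Fin using (Fin; toℕ; fromℕ<)
open import Data.Fin.Properties using () renaming (_≟_ to _≟F_)
open import Data.Nat.Properties using () renaming (_≟_ to _≟ℕ_)
open import Data.Product using (Σ; ∃; ∃-syntax; _×_; _,_)
open import Relation.Nullary using (¬_; does)
open import Relation.Binary.PropositionalEquality using (_≡_)
open import Relation.Binary.Construct.Closure.ReflexiveTransitive using (Star)

sumFin : ∀ {V} → (Fin V → ℕ) → ℕ
sumFin {zero}  f = 0
sumFin {suc V} f = f Fin.zero + sumFin (λ i → f (Fin.suc i))

record Graph : Set where
  field
    V     : ℕ
    adj   : Fin V → Fin V → Bool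
    sym   : ∀ v w → adj v w ≡ adj w v
    irrefl : ∀ v → adj v v ≡ false

module _ (G : Graph) where
  open Graph G

  degree : Fin V → ℕ
  degree v = sumFin (λ w → if adj v w then 1 else 0)

  -- A set of arrows: X v w = true means the arrow (v,w) (from v to w) is in X.
  Arrows : Set
  Arrows = Fin V → Fin V → Bool

  IsDecoration : Arrows → Set
  IsDecoration X = (∀ v w → X v w ≡ true → adj v w ≡ true)
                 × (∀ v w → X v w ≡ true → X w v ≡ false)

  IsSink : Arrows → Fin V → Set
  IsSink X v = ∀ w → adj v w ≡ true → X w v ≡ true

  IsSource : Arrows → Fin V → Set
  IsSource X v = ∀ w → adj v w ≡ true → X v w ≡ true

  IsState : Arrows → Set
  IsState X = IsDecoration X
            × (∀ v → 2 ≤ degree v → ¬ IsSink X v × ¬ IsSource X v)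

  Unmarked : Arrows → Fin V → Fin V → Set
  Unmarked X v w = adj v w ≡ true × X v w ≡ false × X w v ≡ false

  addArrow : Arrows → Fin V → Fin V → Arrows
  addArrow X v w a b = X a b ∨ (does (a ≟F v) ∧ does (b ≟F w))

  Follower : Arrows → Arrows → Set
  Follower X Y = IsState Y × ∃[ v ] ∃[ w ] (Unmarked X v w × (∀ a b → Y a b ≡ addArrow X v w a b))

  SelfOrDescendent : Arrows → Arrows → Set
  SelfOrDescendent = Star Follower

  IsTerminal : Arrows → Set
  IsTerminal X = IsState X × ¬ (∃[ Y ] Follower X Y)

  diffCard : Arrows → Arrows → ℕ
  diffCard Y X = sumFin (λ a → sumFin (λ b → if Y a b ∧ not (X a b) then 1 else 0))

  EvenMovesState : Arrows → Set
  EvenMovesState X = IsState X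
    × (∀ Y → SelfOrDescendent X Y → IsTerminal Y → diffCard Y X % 2 ≡ 0)

  OddMovesState : Arrows → Set
  OddMovesState X = IsState X
    × (∀ Y → SelfOrDescendent X Y → IsTerminal Y → diffCard Y X % 2 ≡ 1)

-- The path with vertices -1,0,...,n+1; vertex k is represented by index k+1,
-- so the vertex set is Fin (n + 3), with edges {i, i+1}.
pathAdj : (n : ℕ) → Fin (n + 3) → Fin (n + 3) → Bool
pathAdj n i j = does (toℕ j ≟ℕ suc (toℕ i)) ∨ does (toℕ i ≟ℕ suc (toℕ j))

open import Data.Bool.Properties using (∨-comm)
open import Data.Nat.Properties using (1+n≢n)
open import Relation.Nullary using (yes; no)
open import Data.Empty using (⊥-elim)
open import Relation.Binary.PropositionalEquality using (refl)
import Relation.Binary.PropositionalEquality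

pathAdj-sym : ∀ n (v w : Fin (n + 3)) → pathAdj n v w ≡ pathAdj n w v
pathAdj-sym n v w = ∨-comm (does (toℕ w ≟ℕ suc (toℕ v))) (does (toℕ v ≟ℕ suc (toℕ w)))

≡ᵇ-suc : ∀ x → (x Data.Nat.≡ᵇ suc x) ≡ false
≡ᵇ-suc zero = refl
≡ᵇ-suc (suc x) = ≡ᵇ-suc x

pathAdj-irrefl : ∀ n (v : Fin (n + 3)) → pathAdj n v v ≡ false
pathAdj-irrefl n v rewrite ≡ᵇ-suc (toℕ v) = refl

Path : ℕ → Graph
Path n = record { V = n + 3 ; adj = pathAdj n ; sym = pathAdj-sym n ; irrefl = pathAdj-irrefl n }

isArrow : ∀ {m} → ℕ → ℕ → Fin m → Fin m → Bool
isArrow x y a b = does (toℕ a ≟ℕ x) ∧ does (toℕ b ≟ℕ y)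

-- F_n = {(-1,0),(n,n+1)} on the path with vertices -1..n+1
F : (n : ℕ) → Arrows (Path n)
F n a b = isArrow 0 1 a b ∨ isArrow (suc n) (suc (suc n)) a b

-- C_n = {(-1,0),(n+1,n)} on the path with vertices -1..n+1 (used for n ≥ 1)
C : (n : ℕ) → Arrows (Path n)
C n a b = isArrow 0 1 a b ∨ isArrow (suc (suc n)) (suc n) a b

-- In a terminal state Y no interior vertex is a sink or
-- a source, so two consecutive marked edges point the same way; and a blank edge between two interior
-- vertices must be blocked in both directions, which forces its two neighbouring edges to be marked with
-- opposite orientations. Walking along the path from the first edge, which points forward, the orientation
-- therefore flips exactly at the blank edges: their number is even iff the last edge points forward, as for
-- F_n, and odd iff it points backward, as for C_(n+1). The moves made from F_n or C_(n+1) are the marked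
-- edges other than the two initial arrows, so moves + blanks = n + 2 - 2 resp. n + 3 - 2, and both have the
-- parity of n.
module Submission where

open import Defs
open import Data.Bool using (Bool; true; false; not; _∧_; _∨_; if_then_else_)
open import Data.Bool.Properties using (∨-identityʳ; ∨-zeroʳ; ∧-zeroʳ; ∧-idem; ∧-comm; ¬-not; T-≡)
open import Data.Empty using (⊥; ⊥-elim)
open import Data.Fin using (Fin; toℕ; fromℕ<) renaming (zero to fzero; suc to fsuc)
open import Data.Fin.Properties using (toℕ-fromℕ<; fromℕ<-toℕ; toℕ<n) renaming (_≟_ to _≟F_)
open import Data.Nat using (ℕ; zero; suc; _+_; _%_; _≤_; _<_; _≡ᵇ_; z≤n; s≤s; parity; _<?_)
open import Data.Nat.Properties
  using ( _≟_; ≡ᵇ⇒≡; suc-injective; 1+n≢n; ≤-refl; ≤-reflexive; ≤-trans; ≤-pred; n≤1+n; m≤n⇒m≤1+n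
        ; m≤m+n; m≤n+m; <-irrefl; <⇒≤; <⇒≢; <⇒≱; 1+n≰n; n<1+n; m<n⇒m<1+n; m<1+n⇒m≤n
        ; m≤n⇒m<n∨m≡n; m<1+n⇒m<n∨m≡n; +-assoc; +-comm; +-identityʳ; +-cancelˡ-≡; +-monoˡ-≤
        ; +-commutativeSemigroup )
open import Data.Parity.Base using (0ℙ; 1ℙ) renaming (_+_ to _⊕_)
open import Data.Parity.Properties using (+-homo-+; p+p≡0ℙ) renaming (+-identityʳ to ⊕-identityʳ)
open import Data.Product using (∃; ∃₂; _×_; _,_; proj₁; proj₂)
open import Data.Sum using (_⊎_; inj₁; inj₂)
open import Function using (_∘_; case_of_; Equivalence)
open import Relation.Nullary using (¬_; Dec; yes; no; does)
open import Relation.Nullary.Decidable using (dec-true; dec-false)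
open import Relation.Binary.Construct.Closure.ReflexiveTransitive using (ε; _◅_)
open import Relation.Binary.PropositionalEquality
open import Algebra.Properties.CommutativeSemigroup +-commutativeSemigroup using (interchange; x∙yz≈y∙xz)

parity⇒%2 : ∀ m n → parity m ≡ parity n → m % 2 ≡ n % 2
parity⇒%2 (suc (suc m)) n             e = parity⇒%2 m n e
parity⇒%2 0             (suc (suc n)) e = parity⇒%2 0 n e
parity⇒%2 1             (suc (suc n)) e = parity⇒%2 1 n e
parity⇒%2 0             0             _ = refl
parity⇒%2 1             1             _ = refl
parity⇒%2 0             1             ()
parity⇒%2 1             0             ()

parity-cancel : ∀ {m k n j} → m + k ≡ n → parity k ≡ parity j → parity m ≡ parity (j + n)
parity-cancel {m} {k} {n} {j} m+k≡n k≡j = sym (begin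
  parity (j + n)                    ≡⟨ cong (parity ∘ (j +_)) (sym m+k≡n) ⟩
  parity (j + (m + k))              ≡⟨ cong parity (x∙yz≈y∙xz j m k) ⟩
  parity (m + (j + k))              ≡⟨ +-homo-+ m (j + k) ⟩
  parity m ⊕ parity (j + k)         ≡⟨ cong (parity m ⊕_) (+-homo-+ j k) ⟩
  parity m ⊕ (parity j ⊕ parity k)  ≡⟨ cong (λ p → parity m ⊕ (parity j ⊕ p)) k≡j ⟩
  parity m ⊕ (parity j ⊕ parity j)  ≡⟨ cong (parity m ⊕_) (p+p≡0ℙ (parity j)) ⟩
  parity m ⊕ 0ℙ                     ≡⟨ ⊕-identityʳ (parity m) ⟩
  parity m                          ∎)
  where open ≡-Reasoning

≡ᵇ-refl : ∀ n → (n ≡ᵇ n) ≡ true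
≡ᵇ-refl n = dec-true (n ≟ n) refl

≡ᵇ-true⇒≡ : ∀ {m n} → (m ≡ᵇ n) ≡ true → m ≡ n
≡ᵇ-true⇒≡ {m} {n} e = ≡ᵇ⇒≡ m n (Equivalence.from T-≡ e)

≡ᵇ-off-by-two : ∀ j n → ((suc j ≡ᵇ n) ∧ (j ≡ᵇ suc n)) ≡ false
≡ᵇ-off-by-two zero    n       = ∧-zeroʳ _
≡ᵇ-off-by-two (suc j) zero    = refl
≡ᵇ-off-by-two (suc j) (suc n) = ≡ᵇ-off-by-two j n

𝟙 : Bool → ℕ
𝟙 b = if b then 1 else 0

not-both-false : ∀ {x y} → (x ≡ false → y ≡ false → ⊥) → x ≡ true ⊎ y ≡ true
not-both-false {true}  _ = inj₁ refl
not-both-false {false} {true} _ = inj₂ refl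
not-both-false {false} {false} h = ⊥-elim (h refl refl)

𝟙-split : ∀ x y → (x ≡ true → y ≡ true) → 𝟙 (y ∧ not x) + 𝟙 x ≡ 𝟙 y
𝟙-split true  y x⇒y rewrite x⇒y refl = refl
𝟙-split false true  _ = refl
𝟙-split false false _ = refl

sumBelow : ℕ → (ℕ → ℕ) → ℕ
sumBelow zero    f = 0
sumBelow (suc k) f = sumBelow k f + f k

sumBelow-cong : ∀ k {f g : ℕ → ℕ} → (∀ i → i < k → f i ≡ g i) → sumBelow k f ≡ sumBelow k g
sumBelow-cong zero    f≗g = refl
sumBelow-cong (suc k) f≗g =
  cong₂ _+_ (sumBelow-cong k (λ i i<k → f≗g i (m<n⇒m<1+n i<k))) (f≗g k ≤-refl)

sumBelow-vanishing : ∀ k f → (∀ i → i < k → f i ≡ 0) → sumBelow k f ≡ 0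
sumBelow-vanishing k f f≡0 = trans (sumBelow-cong k f≡0) (sumBelow-zero k)
  where
  sumBelow-zero : ∀ k → sumBelow k (λ _ → 0) ≡ 0
  sumBelow-zero zero    = refl
  sumBelow-zero (suc k) = trans (+-identityʳ _) (sumBelow-zero k)

sumBelow-const-1 : ∀ k → sumBelow k (λ _ → 1) ≡ k
sumBelow-const-1 zero    = refl
sumBelow-const-1 (suc k) = trans (+-comm (sumBelow k (λ _ → 1)) 1) (cong suc (sumBelow-const-1 k))

sumBelow-distrib-+ : ∀ k f g → sumBelow k (λ i → f i + g i) ≡ sumBelow k f + sumBelow k g
sumBelow-distrib-+ zero    f g = refl
sumBelow-distrib-+ (suc k) f g =
  trans (cong (_+ (f k + g k)) (sumBelow-distrib-+ k f g))
        (interchange (sumBelow k f) (sumBelow k g) (f k) (g k))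

sumBelow-suc : ∀ k f → sumBelow (suc k) f ≡ f 0 + sumBelow k (f ∘ suc)
sumBelow-suc zero    f = +-comm 0 (f 0)
sumBelow-suc (suc k) f = trans (cong (_+ f (suc k)) (sumBelow-suc k f)) (+-assoc (f 0) _ _)

sumFin≡sumBelow : ∀ {m} (f : Fin m → ℕ) (g : ℕ → ℕ) → (∀ i → f i ≡ g (toℕ i)) →
                  sumFin f ≡ sumBelow m g
sumFin≡sumBelow {zero}  f g f≗g = refl
sumFin≡sumBelow {suc m} f g f≗g =
  trans (cong₂ _+_ (f≗g fzero) (sumFin≡sumBelow (f ∘ fsuc) (g ∘ suc) (f≗g ∘ fsuc)))
        (sym (sumBelow-suc m g))

sumBelow-𝟙-vanishing : ∀ k p → (∀ i → i < k → p i ≡ false) → sumBelow k (𝟙 ∘ p) ≡ 0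
sumBelow-𝟙-vanishing k p p≡false = sumBelow-vanishing k (𝟙 ∘ p) (λ i i<k → cong 𝟙 (p≡false i i<k))

sumBelow-𝟙-atMostOne : ∀ k p c → (∀ i → i < k → p i ≡ true → i ≡ c) → sumBelow k (𝟙 ∘ p) ≤ 1
sumBelow-𝟙-atMostOne zero    p c only-c = z≤n
sumBelow-𝟙-atMostOne (suc k) p c only-c with p k in pk
... | false = ≤-trans (≤-reflexive (+-identityʳ _))
                      (sumBelow-𝟙-atMostOne k p c (λ i i<k → only-c i (m<n⇒m<1+n i<k)))
... | true  = ≤-reflexive (cong (_+ 1) (sumBelow-𝟙-vanishing k p none-below))
  where
  none-below : ∀ i → i < k → p i ≡ false
  none-below i i<k =
    ¬-not (λ pi → <-irrefl (trans (only-c i (m<n⇒m<1+n i<k) pi) (sym (only-c k ≤-refl pk))) i<k)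

sumBelow-≥-term : ∀ k f {c} → c < k → f c ≤ sumBelow k f
sumBelow-≥-term (suc k) f {c} c<1+k with m<1+n⇒m<n∨m≡n c<1+k
... | inj₁ c<k  = ≤-trans (sumBelow-≥-term k f c<k) (m≤m+n (sumBelow k f) (f k))
... | inj₂ refl = m≤n+m (f c) (sumBelow c f)

sumBelow-≥-two-terms : ∀ k f {c d} → c < d → d < k → f c + f d ≤ sumBelow k f
sumBelow-≥-two-terms (suc k) f {c} {d} c<d d<1+k with m<1+n⇒m<n∨m≡n d<1+k
... | inj₁ d<k  = ≤-trans (sumBelow-≥-two-terms k f c<d d<k) (m≤m+n (sumBelow k f) (f k))
... | inj₂ refl = +-monoˡ-≤ (f d) (sumBelow-≥-term d f c<d)

sumBelow²-on-path-edges : ∀ E (h : ℕ → ℕ → ℕ) → (∀ a b → b ≢ suc a → a ≢ suc b → h a b ≡ 0) →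
  sumBelow (suc E) (λ a → sumBelow (suc E) (h a)) ≡ sumBelow E (λ i → h i (suc i) + h (suc i) i)
sumBelow²-on-path-edges zero    h h-off = h-off 0 0 (λ ()) (λ ())
sumBelow²-on-path-edges (suc E) h h-off = begin
  sumBelow (suc E) (λ a → sumBelow (suc E) (h a) + h a (suc E))
    + (sumBelow (suc E) (h (suc E)) + h (suc E) (suc E))
    ≡⟨ cong₂ _+_ (sumBelow-distrib-+ (suc E) (λ a → sumBelow (suc E) (h a)) (λ a → h a (suc E)))
                 (cong₂ _+_ last-row (h-off (suc E) (suc E) (1+n≢n ∘ sym) (1+n≢n ∘ sym))) ⟩
  (sumBelow (suc E) (λ a → sumBelow (suc E) (h a)) + sumBelow (suc E) (λ a → h a (suc E)))
    + (h (suc E) E + 0)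
    ≡⟨ cong₂ _+_ (cong₂ _+_ (sumBelow²-on-path-edges E h h-off) last-column) (+-identityʳ _) ⟩
  (S + h E (suc E)) + h (suc E) E
    ≡⟨ +-assoc S (h E (suc E)) (h (suc E) E) ⟩
  S + (h E (suc E) + h (suc E) E) ∎
  where
  open ≡-Reasoning
  S : ℕ
  S = sumBelow E (λ i → h i (suc i) + h (suc i) i)
  beyond : ∀ {i} → i < E → i ≢ suc (suc E)
  beyond i<E refl = <-irrefl refl (≤-trans (n≤1+n _) (m<n⇒m<1+n i<E))
  last-column : sumBelow (suc E) (λ a → h a (suc E)) ≡ h E (suc E)
  last-column = cong (_+ h E (suc E)) (sumBelow-vanishing E _
    (λ a a<E → h-off a (suc E) (λ e → <-irrefl (suc-injective (sym e)) a<E) (beyond a<E)))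
  last-row : sumBelow (suc E) (h (suc E)) ≡ h (suc E) E
  last-row = cong (_+ h (suc E) E) (sumBelow-vanishing E _
    (λ b b<E → h-off (suc E) b (beyond b<E) (λ e → <-irrefl (suc-injective (sym e)) b<E)))

-- Edge i of a path joins vertices i and suc i; r i says that it carries the arrow (i , suc i),
-- l i the arrow (suc i , i).
module EdgeRow (r l : ℕ → Bool) where

  Marked : ℕ → Set
  Marked i = r i ≡ true ⊎ l i ≡ true

  blank : ℕ → Bool
  blank i = not (r i ∨ l i)

  gaps : ℕ → ℕ
  gaps k = sumBelow k (𝟙 ∘ blank)

  marks : ℕ → ℕ
  marks k = sumBelow k (λ i → 𝟙 (r i) + 𝟙 (l i))

  marked-or-blank : ∀ i → Marked i ⊎ (r i ≡ false × l i ≡ false)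
  marked-or-blank i with r i | l i
  ... | true  | _     = inj₁ (inj₁ refl)
  ... | false | true  = inj₁ (inj₂ refl)
  ... | false | false = inj₂ (refl , refl)

  blank-marked : ∀ {i} → Marked i → blank i ≡ false
  blank-marked {i} (inj₁ ri) rewrite ri = refl
  blank-marked {i} (inj₂ li) rewrite li | ∨-zeroʳ (r i) = refl

  marks+gaps : (∀ i → r i ≡ true → l i ≡ false) → ∀ k → marks k + gaps k ≡ k
  marks+gaps exclusive k = begin
    marks k + gaps k                                      ≡⟨ sym (sumBelow-distrib-+ k _ _) ⟩
    sumBelow k (λ i → (𝟙 (r i) + 𝟙 (l i)) + 𝟙 (blank i)) ≡⟨ sumBelow-cong k (λ i _ → one-each i) ⟩
    sumBelow k (λ _ → 1)                                  ≡⟨ sumBelow-const-1 k ⟩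
    k                                                     ∎
    where
    open ≡-Reasoning
    one-each : ∀ i → (𝟙 (r i) + 𝟙 (l i)) + 𝟙 (blank i) ≡ 1
    one-each i with r i in ri | l i in li
    ... | true  | false = refl
    ... | true  | true  = case trans (sym li) (exclusive i ri) of λ ()
    ... | false | true  = refl
    ... | false | false = refl

  parity-gaps-suc : ∀ k → parity (gaps (suc k)) ≡ parity (gaps k) ⊕ parity (𝟙 (blank k))
  parity-gaps-suc k = +-homo-+ (gaps k) (𝟙 (blank k))

  record TerminalPattern (e : ℕ) : Set where
    field
      exclusive     : ∀ i → r i ≡ true → l i ≡ false
      no-sink       : ∀ k → suc k ≤ e → r k ≡ true → l (suc k) ≡ true → ⊥
      no-source     : ∀ k → suc k ≤ e → l k ≡ true → r (suc k) ≡ true → ⊥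
      blank-flanked : ∀ k → suc (suc k) ≤ e → r (suc k) ≡ false → l (suc k) ≡ false →
                      (l k ≡ true ⊎ l (suc (suc k)) ≡ true) × (r k ≡ true ⊎ r (suc (suc k)) ≡ true)
      first-forward : r 0 ≡ true

    consecutive-agree : ∀ {k} → suc k ≤ e → Marked k → Marked (suc k) → l (suc k) ≡ l k
    consecutive-agree {k} _   (inj₁ rk) (inj₁ rk₁) = trans (exclusive (suc k) rk₁) (sym (exclusive k rk))
    consecutive-agree {k} k<e (inj₁ rk) (inj₂ lk₁) = ⊥-elim (no-sink k k<e rk lk₁)
    consecutive-agree {k} k<e (inj₂ lk) (inj₁ rk₁) = ⊥-elim (no-source k k<e lk rk₁)
    consecutive-agree {k} _   (inj₂ lk) (inj₂ lk₁) = trans lk₁ (sym lk)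

    flip-across-blank : ∀ {k} → suc (suc k) ≤ e → r (suc k) ≡ false → l (suc k) ≡ false →
                        Marked k × l (suc (suc k)) ≡ not (l k)
    flip-across-blank {k} k+1<e rb lb with blank-flanked k k+1<e rb lb
    ... | inj₁ lk  , inj₁ rk  = case trans (sym (exclusive k rk)) lk of λ ()
    ... | inj₁ lk  , inj₂ rk₂ = inj₂ lk , trans (exclusive (suc (suc k)) rk₂) (cong not (sym lk))
    ... | inj₂ lk₂ , inj₁ rk  = inj₁ rk , trans lk₂ (cong not (sym (exclusive k rk)))
    ... | inj₂ lk₂ , inj₂ rk₂ = case trans (sym (exclusive (suc (suc k)) rk₂)) lk₂ of λ ()

    -- a blank edge reverses the orientation, so the blanks count the reversals since the forward edge 0
    gaps-parity : ∀ k → k ≤ e → Marked k → parity (gaps (suc k)) ≡ parity (𝟙 (l k))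
    gaps-parity zero _ _ rewrite first-forward | exclusive 0 first-forward = refl
    gaps-parity (suc k) k<e m with marked-or-blank k
    gaps-parity (suc k) k<e m | inj₁ mk = begin
      parity (gaps (suc (suc k)))
        ≡⟨ parity-gaps-suc (suc k) ⟩
      parity (gaps (suc k)) ⊕ parity (𝟙 (blank (suc k)))
        ≡⟨ cong₂ _⊕_ (gaps-parity k (≤-trans (n≤1+n k) k<e) mk) (cong (parity ∘ 𝟙) (blank-marked m)) ⟩
      parity (𝟙 (l k)) ⊕ 0ℙ
        ≡⟨ ⊕-identityʳ _ ⟩
      parity (𝟙 (l k))
        ≡⟨ cong (parity ∘ 𝟙) (sym (consecutive-agree k<e mk m)) ⟩
      parity (𝟙 (l (suc k))) ∎
      where open ≡-Reasoning
    gaps-parity (suc zero) _ _ | inj₂ (r0 , _) = case trans (sym first-forward) r0 of λ ()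
    gaps-parity (suc (suc j)) j+1<e m | inj₂ (rb , lb) = begin
      parity (gaps (suc (suc (suc j))))
        ≡⟨ trans (parity-gaps-suc (suc (suc j)))
                 (cong (_⊕ parity (𝟙 (blank (suc (suc j))))) (parity-gaps-suc (suc j))) ⟩
      (parity (gaps (suc j)) ⊕ parity (𝟙 (blank (suc j)))) ⊕ parity (𝟙 (blank (suc (suc j))))
        ≡⟨ cong₂ (λ p q → (p ⊕ parity (𝟙 (blank (suc j)))) ⊕ q)
                 (gaps-parity j (≤-trans (n≤1+n j) (≤-trans (n≤1+n _) j+1<e)) mj)
                 (cong (parity ∘ 𝟙) (blank-marked m)) ⟩
      (parity (𝟙 (l j)) ⊕ parity (𝟙 (blank (suc j)))) ⊕ 0ℙ
        ≡⟨ cong (λ b → (parity (𝟙 (l j)) ⊕ parity (𝟙 (not b))) ⊕ 0ℙ) (cong₂ _∨_ rb lb) ⟩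
      (parity (𝟙 (l j)) ⊕ 1ℙ) ⊕ 0ℙ
        ≡⟨ parity-flip (l j) ⟩
      parity (𝟙 (not (l j)))
        ≡⟨ cong (parity ∘ 𝟙) (sym l₂) ⟩
      parity (𝟙 (l (suc (suc j)))) ∎
      where
      open ≡-Reasoning
      mj : Marked j
      mj = proj₁ (flip-across-blank j+1<e rb lb)
      l₂ : l (suc (suc j)) ≡ not (l j)
      l₂ = proj₂ (flip-across-blank j+1<e rb lb)
      parity-flip : ∀ b → (parity (𝟙 b) ⊕ 1ℙ) ⊕ 0ℙ ≡ parity (𝟙 (not b))
      parity-flip true  = refl
      parity-flip false = refl

_⊆_ : ∀ {m} → (Fin m → Fin m → Bool) → (Fin m → Fin m → Bool) → Set
R ⊆ S = ∀ x y → R x y ≡ true → S x y ≡ true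

-- R read on vertex numbers, with the junk value false out of range
relℕ : ∀ {m} → (Fin m → Fin m → Bool) → ℕ → ℕ → Bool
relℕ {m} R a b with a <? m | b <? m
... | yes a<m | yes b<m = R (fromℕ< a<m) (fromℕ< b<m)
... | _       | _       = false

module _ {m : ℕ} (R : Fin m → Fin m → Bool) where

  relℕ-fromℕ< : ∀ {a b} (a<m : a < m) (b<m : b < m) → relℕ R a b ≡ R (fromℕ< a<m) (fromℕ< b<m)
  relℕ-fromℕ< {a} {b} a<m b<m with a <? m | b <? m
  ... | yes _   | yes _   = refl
  ... | no a≮m  | _       = ⊥-elim (a≮m a<m)
  ... | yes _   | no b≮m  = ⊥-elim (b≮m b<m)

  relℕ-at : ∀ {x y a b} → toℕ x ≡ a → toℕ y ≡ b → relℕ R a b ≡ R x y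
  relℕ-at {x} {y} refl refl =
    trans (relℕ-fromℕ< (toℕ<n x) (toℕ<n y)) (cong₂ R (fromℕ<-toℕ x _) (fromℕ<-toℕ y _))

  relℕ-true : ∀ {a b} → relℕ R a b ≡ true → ∃₂ λ x y → toℕ x ≡ a × toℕ y ≡ b × R x y ≡ true
  relℕ-true {a} {b} e with a <? m | b <? m
  ... | yes a<m | yes b<m = fromℕ< a<m , fromℕ< b<m , toℕ-fromℕ< a<m , toℕ-fromℕ< b<m , e

relℕ-mono : ∀ {m} {R S : Fin m → Fin m → Bool} → R ⊆ S → ∀ {a b} → relℕ R a b ≡ true → relℕ S a b ≡ true
relℕ-mono {R = R} {S = S} R⊆S {a} {b} e with relℕ-true R {a} {b} e
... | x , y , refl , refl , Rxy = trans (relℕ-at S refl refl) (R⊆S x y Rxy)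

module _ (G : Graph) where
  open Graph G using (adj; irrefl)

  descendent-⊇ : ∀ {X Y} → SelfOrDescendent G X Y → X ⊆ Y
  descendent-⊇ ε x y Xxy = Xxy
  descendent-⊇ ((_ , v , w , _ , Z≡X+vw) ◅ Z↝Y) x y Xxy =
    descendent-⊇ Z↝Y x y (trans (Z≡X+vw x y) (cong (_∨ _) Xxy))

  addArrow-elsewhere : ∀ Y {v w x y} → x ≢ v ⊎ y ≢ w → addArrow G Y v w x y ≡ Y x y
  addArrow-elsewhere Y {v} {w} {x} {y} (inj₁ x≢v) =
    trans (cong (λ c → Y x y ∨ (c ∧ does (y ≟F w))) (dec-false (x ≟F v) x≢v)) (∨-identityʳ _)
  addArrow-elsewhere Y {v} {w} {x} {y} (inj₂ y≢w) =
    trans (cong (λ c → Y x y ∨ (does (x ≟F v) ∧ c)) (dec-false (y ≟F w) y≢w))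
          (trans (cong (Y x y ∨_) (∧-zeroʳ _)) (∨-identityʳ _))

  addArrow-true : ∀ Y {v w x y} → addArrow G Y v w x y ≡ true → Y x y ≡ true ⊎ (x ≡ v × y ≡ w)
  addArrow-true Y {v} {w} {x} {y} e with x ≟F v | y ≟F w
  ... | yes x≡v | yes y≡w = inj₂ (x≡v , y≡w)
  ... | no _    | _       = inj₁ (trans (sym (∨-identityʳ _)) e)
  ... | yes _   | no _    = inj₁ (trans (sym (∨-identityʳ _)) e)

  addArrow-follower : ∀ {Y v w a b} → IsState G Y → Unmarked G Y v w →
                      adj v a ≡ true → Y v a ≡ false → a ≢ w →
                      adj w b ≡ true → Y b w ≡ false → b ≢ v →
                      Follower G Y (addArrow G Y v w)
  addArrow-follower {Y} {v} {w} {a} {b} ((on-edges , antisym) , balanced) unmarked@(vw , Yvw , Ywv)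
                    va Yva a≢w wb Ybw b≢v =
    ((on-edges′ , antisym′) , balanced′) , v , w , unmarked , λ _ _ → refl
    where
    Y′ : Arrows G
    Y′ = addArrow G Y v w
    v≢w : v ≢ w
    v≢w refl = case trans (sym (irrefl v)) vw of λ ()

    on-edges′ : ∀ x y → Y′ x y ≡ true → adj x y ≡ true
    on-edges′ x y e with addArrow-true Y e
    ... | inj₁ Yxy          = on-edges x y Yxy
    ... | inj₂ (refl , refl) = vw

    antisym′ : ∀ x y → Y′ x y ≡ true → Y′ y x ≡ false
    antisym′ x y e with addArrow-true Y e
    ... | inj₂ (refl , refl) = trans (addArrow-elsewhere Y (inj₁ (v≢w ∘ sym))) Ywv
    ... | inj₁ Yxy = trans (addArrow-elsewhere Y (not-new (y ≟F v))) (antisym x y Yxy)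
      where
      not-new : Dec (y ≡ v) → y ≢ v ⊎ x ≢ w
      not-new (no y≢v)   = inj₁ y≢v
      not-new (yes refl) = inj₂ λ { refl → case trans (sym Ywv) Yxy of λ () }

    balanced′ : ∀ u → 2 ≤ degree G u → ¬ IsSink G Y′ u × ¬ IsSource G Y′ u
    balanced′ u deg = no-sink (u ≟F w) , no-source (u ≟F v)
      where
      no-sink : Dec (u ≡ w) → ¬ IsSink G Y′ u
      no-sink (yes refl) sink =
        case trans (sym (sink b wb)) (trans (addArrow-elsewhere Y (inj₁ b≢v)) Ybw) of λ ()
      no-sink (no u≢w)   sink =
        proj₁ (balanced u deg) λ x xu → trans (sym (addArrow-elsewhere Y (inj₂ u≢w))) (sink x xu)
      no-source : Dec (u ≡ v) → ¬ IsSource G Y′ u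
      no-source (yes refl) source =
        case trans (sym (source a va)) (trans (addArrow-elsewhere Y (inj₂ a≢w)) Yva) of λ ()
      no-source (no u≢v)   source =
        proj₂ (balanced u deg) λ x ux → trans (sym (addArrow-elsewhere Y (inj₁ u≢v))) (source x ux)

module PathGraph (n : ℕ) where

  size : n + 3 ≡ suc (suc (suc n))
  size = +-comm n 3

  vertex : (k : ℕ) → k ≤ suc (suc n) → Fin (n + 3)
  vertex k k≤ = fromℕ< (subst (k <_) (sym size) (s≤s k≤))

  toℕ-vertex : ∀ {k} (k≤ : k ≤ suc (suc n)) → toℕ (vertex k k≤) ≡ k
  toℕ-vertex k≤ = toℕ-fromℕ< _

  vertex-≢ : ∀ {i j} (i≤ : i ≤ suc (suc n)) (j≤ : j ≤ suc (suc n)) →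
             i ≢ j → vertex i i≤ ≢ vertex j j≤
  vertex-≢ i≤ j≤ i≢j e = i≢j (trans (sym (toℕ-vertex i≤)) (trans (cong toℕ e) (toℕ-vertex j≤)))

  toℕ≤ : (x : Fin (n + 3)) → toℕ x ≤ suc (suc n)
  toℕ≤ x = m<1+n⇒m≤n (subst (toℕ x <_) size (toℕ<n x))

  adjℕ : ℕ → ℕ → Bool
  adjℕ a b = (b ≡ᵇ suc a) ∨ (a ≡ᵇ suc b)

  adjℕ-true : ∀ {a b} → adjℕ a b ≡ true → b ≡ suc a ⊎ a ≡ suc b
  adjℕ-true {a} {b} e with b ≡ᵇ suc a in b≡1+a
  ... | true  = inj₁ (≡ᵇ-true⇒≡ b≡1+a)
  ... | false = inj₂ (≡ᵇ-true⇒≡ e)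

  adj-succ : ∀ x y → toℕ y ≡ suc (toℕ x) → pathAdj n x y ≡ true
  adj-succ x y e = cong (_∨ (toℕ x ≡ᵇ suc (toℕ y))) (dec-true (toℕ y ≟ suc (toℕ x)) e)

  adj-pred : ∀ x y → toℕ x ≡ suc (toℕ y) → pathAdj n x y ≡ true
  adj-pred x y e = trans (pathAdj-sym n x y) (adj-succ y x e)

  vertex-step : ∀ {i} (i≤ : i ≤ suc (suc n)) (j≤ : suc i ≤ suc (suc n)) →
                pathAdj n (vertex i i≤) (vertex (suc i) j≤) ≡ true
  vertex-step i≤ j≤ =
    adj-succ (vertex _ i≤) (vertex _ j≤) (trans (toℕ-vertex j≤) (cong suc (sym (toℕ-vertex i≤))))

  vertex-step⁻¹ : ∀ {i} (i≤ : i ≤ suc (suc n)) (j≤ : suc i ≤ suc (suc n)) →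
                  pathAdj n (vertex (suc i) j≤) (vertex i i≤) ≡ true
  vertex-step⁻¹ i≤ j≤ = trans (pathAdj-sym n (vertex _ j≤) (vertex _ i≤)) (vertex-step i≤ j≤)

  neighbours : ∀ {v w k} → toℕ v ≡ suc k → pathAdj n v w ≡ true →
               toℕ w ≡ k ⊎ toℕ w ≡ suc (suc k)
  neighbours v≡1+k vw with adjℕ-true vw
  ... | inj₁ w≡1+v = inj₂ (trans w≡1+v (cong suc v≡1+k))
  ... | inj₂ v≡1+w = inj₁ (suc-injective (trans (sym v≡1+w) v≡1+k))

  degree≡ : ∀ x → degree (Path n) x ≡ sumBelow (n + 3) (𝟙 ∘ adjℕ (toℕ x))
  degree≡ x = sumFin≡sumBelow (𝟙 ∘ pathAdj n x) (𝟙 ∘ adjℕ (toℕ x)) (λ _ → refl)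

  interior⇒2≤degree : ∀ {x t} → toℕ x ≡ suc t → t ≤ n → 2 ≤ degree (Path n) x
  interior⇒2≤degree {x} {t} x≡1+t t≤n =
    subst (2 ≤_) (sym (trans (degree≡ x) (cong (λ a → sumBelow (n + 3) (𝟙 ∘ adjℕ a)) x≡1+t)))
          two-neighbours
    where
    left : 𝟙 (adjℕ (suc t) t) ≡ 1
    left = cong 𝟙 (trans (cong ((t ≡ᵇ suc (suc t)) ∨_) (≡ᵇ-refl t)) (∨-zeroʳ _))
    right : 𝟙 (adjℕ (suc t) (suc (suc t))) ≡ 1
    right = cong (λ b → 𝟙 (b ∨ (suc t ≡ᵇ suc (suc (suc t))))) (≡ᵇ-refl t)
    two-neighbours : 2 ≤ sumBelow (n + 3) (𝟙 ∘ adjℕ (suc t))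
    two-neighbours = subst (_≤ sumBelow (n + 3) (𝟙 ∘ adjℕ (suc t))) (cong₂ _+_ left right)
      (sumBelow-≥-two-terms (n + 3) (𝟙 ∘ adjℕ (suc t)) (m<n⇒m<1+n (n<1+n t))
                            (subst (suc (suc t) <_) (sym size) (s≤s (s≤s (s≤s t≤n)))))

  2≤degree⇒interior : ∀ x → 2 ≤ degree (Path n) x → ∃ λ t → toℕ x ≡ suc t × t ≤ n
  2≤degree⇒interior x 2≤deg = classify (toℕ x) refl (toℕ≤ x)
    where
    degree≤1 : ∀ c → (∀ b → b < n + 3 → adjℕ (toℕ x) b ≡ true → b ≡ c) → ⊥
    degree≤1 c only-c =
      <⇒≱ 2≤deg (subst (_≤ 1) (sym (degree≡ x)) (sumBelow-𝟙-atMostOne (n + 3) (adjℕ (toℕ x)) c only-c))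
    classify : ∀ a → toℕ x ≡ a → a ≤ suc (suc n) → ∃ λ t → toℕ x ≡ suc t × t ≤ n
    classify zero x≡0 _ = ⊥-elim (degree≤1 1 only-1)
      where
      only-1 : ∀ b → b < n + 3 → adjℕ (toℕ x) b ≡ true → b ≡ 1
      only-1 b _ e with adjℕ-true e
      ... | inj₁ b≡1+x = trans b≡1+x (cong suc x≡0)
      ... | inj₂ x≡1+b = case trans (sym x≡0) x≡1+b of λ ()
    classify (suc t) x≡1+t (s≤s t≤1+n) with m≤n⇒m<n∨m≡n t≤1+n
    ... | inj₁ t<1+n = t , x≡1+t , m<1+n⇒m≤n t<1+n
    ... | inj₂ refl  = ⊥-elim (degree≤1 (suc n) only-1+n)
      where
      only-1+n : ∀ b → b < n + 3 → adjℕ (toℕ x) b ≡ true → b ≡ suc n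
      only-1+n b b<n+3 e with adjℕ-true e
      ... | inj₁ b≡1+x = ⊥-elim (<-irrefl (trans (trans b≡1+x (cong suc x≡1+t)) (sym size)) b<n+3)
      ... | inj₂ x≡1+b = suc-injective (sym (trans (sym x≡1+t) x≡1+b))

  forward backward : Arrows (Path n) → ℕ → Bool
  forward  Y i = relℕ Y i (suc i)
  backward Y i = relℕ Y (suc i) i

  module _ (Y : Arrows (Path n)) where

    at-vertices : ∀ {i j} (i≤ : i ≤ suc (suc n)) (j≤ : j ≤ suc (suc n)) →
                  Y (vertex i i≤) (vertex j j≤) ≡ relℕ Y i j
    at-vertices i≤ j≤ = sym (relℕ-at Y (toℕ-vertex i≤) (toℕ-vertex j≤))

    toward : ∀ {v k} → toℕ v ≡ suc k → relℕ Y k (suc k) ≡ true → relℕ Y (suc (suc k)) (suc k) ≡ true →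
             IsSink (Path n) Y v
    toward v≡1+k from-left from-right w vw with neighbours v≡1+k vw
    ... | inj₁ w≡k   = trans (sym (relℕ-at Y w≡k v≡1+k)) from-left
    ... | inj₂ w≡2+k = trans (sym (relℕ-at Y w≡2+k v≡1+k)) from-right

    away : ∀ {v k} → toℕ v ≡ suc k → relℕ Y (suc k) k ≡ true → relℕ Y (suc k) (suc (suc k)) ≡ true →
           IsSource (Path n) Y v
    away v≡1+k to-left to-right w vw with neighbours v≡1+k vw
    ... | inj₁ w≡k   = trans (sym (relℕ-at Y v≡1+k w≡k)) to-left
    ... | inj₂ w≡2+k = trans (sym (relℕ-at Y v≡1+k w≡2+k)) to-right

    forward⇒¬backward : IsDecoration (Path n) Y → ∀ i → forward Y i ≡ true → backward Y i ≡ false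
    forward⇒¬backward (_ , antisym) i e with relℕ-true Y e
    ... | x , y , refl , y≡1+x , Yxy = trans (relℕ-at Y y≡1+x refl) (antisym x y Yxy)

    no-inner-sink : IsState (Path n) Y → ∀ k → suc k ≤ suc n →
                    forward Y k ≡ true → backward Y (suc k) ≡ true → ⊥
    no-inner-sink (_ , balanced) k k<e rk lk₁ =
      proj₁ (balanced _ (interior⇒2≤degree (toℕ-vertex (m≤n⇒m≤1+n k<e)) (≤-pred k<e)))
            (toward (toℕ-vertex (m≤n⇒m≤1+n k<e)) rk lk₁)

    no-inner-source : IsState (Path n) Y → ∀ k → suc k ≤ suc n →
                      backward Y k ≡ true → forward Y (suc k) ≡ true → ⊥
    no-inner-source (_ , balanced) k k<e lk rk₁ =
      proj₂ (balanced _ (interior⇒2≤degree (toℕ-vertex (m≤n⇒m≤1+n k<e)) (≤-pred k<e)))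
            (away (toℕ-vertex (m≤n⇒m≤1+n k<e)) lk rk₁)

    -- otherwise an arrow could still be put on the blank edge suc k, in one direction or the other
    blank-flanked : IsTerminal (Path n) Y → ∀ k → suc (suc k) ≤ suc n →
                    forward Y (suc k) ≡ false → backward Y (suc k) ≡ false →
                    (backward Y k ≡ true ⊎ backward Y (suc (suc k)) ≡ true) ×
                    (forward Y k ≡ true ⊎ forward Y (suc (suc k)) ≡ true)
    blank-flanked (state , no-follower) k k+1<e rb lb =
        not-both-false (λ lk lk₂ → no-follower (_ , addArrow-follower (Path n) state
          (vertex-step b₁ b₂ , trans (at-vertices b₁ b₂) rb , trans (at-vertices b₂ b₁) lb)
          (vertex-step⁻¹ b₀ b₁) (trans (at-vertices b₁ b₀) lk) (vertex-≢ b₀ b₂ (λ ()))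
          (vertex-step b₂ b₃) (trans (at-vertices b₃ b₂) lk₂) (vertex-≢ b₃ b₁ (λ ()))))
      , not-both-false (λ rk rk₂ → no-follower (_ , addArrow-follower (Path n) state
          (vertex-step⁻¹ b₁ b₂ , trans (at-vertices b₂ b₁) lb , trans (at-vertices b₁ b₂) rb)
          (vertex-step b₂ b₃) (trans (at-vertices b₂ b₃) rk₂) (vertex-≢ b₃ b₁ (λ ()))
          (vertex-step⁻¹ b₀ b₁) (trans (at-vertices b₀ b₁) rk) (vertex-≢ b₀ b₂ (λ ()))))
      where
      b₃ : suc (suc (suc k)) ≤ suc (suc n)
      b₃ = s≤s k+1<e
      b₂ : suc (suc k) ≤ suc (suc n)
      b₂ = m≤n⇒m≤1+n k+1<e
      b₁ : suc k ≤ suc (suc n)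
      b₁ = ≤-trans (n≤1+n _) b₂
      b₀ : k ≤ suc (suc n)
      b₀ = ≤-trans (n≤1+n _) b₁

    terminal-pattern : IsTerminal (Path n) Y → forward Y 0 ≡ true →
                       EdgeRow.TerminalPattern (forward Y) (backward Y) (suc n)
    terminal-pattern terminal@(state , _) first = record
      { exclusive     = forward⇒¬backward (proj₁ state)
      ; no-sink       = no-inner-sink state
      ; no-source     = no-inner-source state
      ; blank-flanked = blank-flanked terminal
      ; first-forward = first
      }

  diffCard-on-path : ∀ {X Y} → X ⊆ Y → IsDecoration (Path n) Y →
    diffCard (Path n) Y X + EdgeRow.marks (forward X) (backward X) (suc (suc n))
      ≡ EdgeRow.marks (forward Y) (backward Y) (suc (suc n))
  diffCard-on-path {X} {Y} X⊆Y (on-edges , _) = begin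
    diffCard (Path n) Y X + marks X
      ≡⟨ cong (_+ marks X) diffCard≡ ⟩
    sumBelow E (λ i → new i (suc i) + new (suc i) i) + marks X
      ≡⟨ sym (sumBelow-distrib-+ E _ _) ⟩
    sumBelow E (λ i → (new i (suc i) + new (suc i) i) + (𝟙 (forward X i) + 𝟙 (backward X i)))
      ≡⟨ sumBelow-cong E (λ i _ → new+old i) ⟩
    marks Y ∎
    where
    open ≡-Reasoning
    E : ℕ
    E = suc (suc n)
    marks : Arrows (Path n) → ℕ
    marks Z = EdgeRow.marks (forward Z) (backward Z) E
    new : ℕ → ℕ → ℕ
    new a b = 𝟙 (relℕ Y a b ∧ not (relℕ X a b))

    new-off-edges : ∀ a b → b ≢ suc a → a ≢ suc b → new a b ≡ 0
    new-off-edges a b b≢1+a a≢1+b with relℕ Y a b in Yab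
    ... | false = refl
    ... | true with relℕ-true Y Yab
    ...   | x , y , refl , refl , Yxy with adjℕ-true (on-edges x y Yxy)
    ...     | inj₁ y≡1+x = ⊥-elim (b≢1+a y≡1+x)
    ...     | inj₂ x≡1+y = ⊥-elim (a≢1+b x≡1+y)

    diffCard≡ : diffCard (Path n) Y X ≡ sumBelow E (λ i → new i (suc i) + new (suc i) i)
    diffCard≡ = begin
      diffCard (Path n) Y X
        ≡⟨ sumFin≡sumBelow _ (λ a → sumBelow (n + 3) (new a)) (λ x → sumFin≡sumBelow _ (new (toℕ x))
             (λ y → cong₂ (λ p q → 𝟙 (p ∧ not q)) (sym (relℕ-at Y refl refl)) (sym (relℕ-at X refl refl)))) ⟩
      sumBelow (n + 3) (λ a → sumBelow (n + 3) (new a))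
        ≡⟨ cong (λ m → sumBelow m (λ a → sumBelow m (new a))) size ⟩
      sumBelow (suc E) (λ a → sumBelow (suc E) (new a))
        ≡⟨ sumBelow²-on-path-edges E new new-off-edges ⟩
      sumBelow E (λ i → new i (suc i) + new (suc i) i) ∎

    new+old : ∀ i → (new i (suc i) + new (suc i) i) + (𝟙 (forward X i) + 𝟙 (backward X i))
                    ≡ 𝟙 (forward Y i) + 𝟙 (backward Y i)
    new+old i = trans (interchange (new i (suc i)) (new (suc i) i) _ _)
                      (cong₂ _+_ (𝟙-split _ _ (relℕ-mono X⊆Y)) (𝟙-split _ _ (relℕ-mono X⊆Y)))

lastArrow : ℕ → Bool → ℕ × ℕ
lastArrow n false = suc n , suc (suc n)
lastArrow n true  = suc (suc n) , suc n

arrowℕ : ℕ × ℕ → ℕ → ℕ → Bool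
arrowℕ (x , y) a b = (a ≡ᵇ x) ∧ (b ≡ᵇ y)

endsℕ : ℕ → Bool → ℕ → ℕ → Bool
endsℕ n d a b = arrowℕ (0 , 1) a b ∨ arrowℕ (lastArrow n d) a b

-- The state {(-1,0), e} with e on the last edge, pointing backwards iff d:
-- F n is ends n false and C n is ends n true.
ends : (n : ℕ) → Bool → Arrows (Path n)
ends n d x y = endsℕ n d (toℕ x) (toℕ y)

arrowℕ-true : ∀ {p a b} → arrowℕ p a b ≡ true → (a , b) ≡ p
arrowℕ-true {x , y} {a} {b} e with a ≡ᵇ x in a≡x | b ≡ᵇ y in b≡y
... | true  | true  = cong₂ _,_ (≡ᵇ-true⇒≡ a≡x) (≡ᵇ-true⇒≡ b≡y)
... | true  | false = case e of λ ()
... | false | _     = case e of λ ()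

endsℕ-true : ∀ {n d a b} → endsℕ n d a b ≡ true → (a , b) ≡ (0 , 1) ⊎ (a , b) ≡ lastArrow n d
endsℕ-true {n} {d} {a} {b} e with arrowℕ (0 , 1) a b in first
... | true  = inj₁ (arrowℕ-true first)
... | false = inj₂ (arrowℕ-true e)

endsℕ-on-edges : ∀ n d {a b} → endsℕ n d a b ≡ true → b ≡ suc a ⊎ a ≡ suc b
endsℕ-on-edges n false {a} {b} e with endsℕ-true {n} {false} {a} {b} e
... | inj₁ refl = inj₁ refl
... | inj₂ refl = inj₁ refl
endsℕ-on-edges n true {a} {b} e with endsℕ-true {n} {true} {a} {b} e
... | inj₁ refl = inj₁ refl
... | inj₂ refl = inj₂ refl

endsℕ-antisym : ∀ n d {a b} → endsℕ n d a b ≡ true → endsℕ n d b a ≡ true → ⊥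
endsℕ-antisym n false {a} {b} e e′ with endsℕ-true {n} {false} {a} {b} e | endsℕ-true {n} {false} {b} {a} e′
... | inj₁ refl | inj₁ ()
... | inj₁ refl | inj₂ ()
... | inj₂ refl | inj₁ ()
... | inj₂ refl | inj₂ ()
endsℕ-antisym n true {a} {b} e e′ with endsℕ-true {n} {true} {a} {b} e | endsℕ-true {n} {true} {b} {a} e′
... | inj₁ refl | inj₁ ()
... | inj₁ refl | inj₂ ()
... | inj₂ refl | inj₁ ()
... | inj₂ refl | inj₂ ()

endsℕ-not-leftward : ∀ n d {t} → t ≤ n → endsℕ n d (suc t) t ≡ false
endsℕ-not-leftward n false {t} t≤n = ¬-not λ e → case endsℕ-true {n} {false} {suc t} {t} e of λ
  { (inj₁ ()) ; (inj₂ ()) }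
endsℕ-not-leftward n true  {t} t≤n = ¬-not λ e → case endsℕ-true {n} {true} {suc t} {t} e of λ
  { (inj₁ ()) ; (inj₂ refl) → 1+n≰n t≤n }

-- the excluded case d = true, n = 0 is C_0, whose middle vertex is a sink
endsℕ-not-into : ∀ n d t → t ≤ n → (d ≡ true → n ≢ 0) →
                 endsℕ n d t (suc t) ≡ false ⊎ endsℕ n d (suc (suc t)) (suc t) ≡ false
endsℕ-not-into n false zero    _   _      = inj₂ (¬-not λ e → case endsℕ-true {n} {false} {2} {1} e of λ
  { (inj₁ ()) ; (inj₂ ()) })
endsℕ-not-into n true  zero    _   n≢0    = inj₂ (¬-not λ e → case endsℕ-true {n} {true} {2} {1} e of λ
  { (inj₁ ()) ; (inj₂ refl) → n≢0 refl refl })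
endsℕ-not-into n false (suc s) s<n _      = inj₁ (¬-not λ e →
  case endsℕ-true {n} {false} {suc s} {suc (suc s)} e of λ
  { (inj₁ ()) ; (inj₂ refl) → 1+n≰n s<n })
endsℕ-not-into n true  (suc s) s<n _      = inj₁ (¬-not λ e →
  case endsℕ-true {n} {true} {suc s} {suc (suc s)} e of λ
  { (inj₁ ()) ; (inj₂ ()) })

endsℕ-edge : ∀ n d i → 𝟙 (endsℕ n d i (suc i)) + 𝟙 (endsℕ n d (suc i) i)
                       ≡ 𝟙 (i ≡ᵇ 0) + 𝟙 (i ≡ᵇ suc n)
endsℕ-edge n false zero    = cong (λ b → 1 + 𝟙 b) (∧-zeroʳ (0 ≡ᵇ n))
endsℕ-edge n true  zero    = refl
endsℕ-edge n false (suc j) =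
  trans (cong₂ (λ p q → 𝟙 p + 𝟙 q) (∧-idem (j ≡ᵇ n)) (≡ᵇ-off-by-two j n)) (+-identityʳ _)
endsℕ-edge n true  (suc j) =
  cong₂ (λ p q → 𝟙 p + 𝟙 q) (trans (∧-comm (j ≡ᵇ suc n) _) (≡ᵇ-off-by-two j n)) (∧-idem (j ≡ᵇ n))

ends-isState : ∀ n d → (d ≡ true → n ≢ 0) → IsState (Path n) (ends n d)
ends-isState n d nondegenerate = (on-edges , antisym) , balanced
  where
  open PathGraph n
  on-edges : ∀ x y → ends n d x y ≡ true → pathAdj n x y ≡ true
  on-edges x y e with endsℕ-on-edges n d {toℕ x} {toℕ y} e
  ... | inj₁ y≡1+x = adj-succ x y y≡1+x
  ... | inj₂ x≡1+y = adj-pred x y x≡1+y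

  antisym : ∀ x y → ends n d x y ≡ true → ends n d y x ≡ false
  antisym x y e = ¬-not (endsℕ-antisym n d {toℕ x} {toℕ y} e)

  balanced : ∀ u → 2 ≤ degree (Path n) u →
             ¬ IsSink (Path n) (ends n d) u × ¬ IsSource (Path n) (ends n d) u
  balanced u deg with 2≤degree⇒interior u deg
  ... | t , u≡1+t , t≤n = no-sink (endsℕ-not-into n d t t≤n nondegenerate) , no-source
    where
    t≤ : t ≤ suc (suc n)
    t≤ = ≤-trans t≤n (≤-trans (n≤1+n n) (n≤1+n (suc n)))
    2+t≤ : suc (suc t) ≤ suc (suc n)
    2+t≤ = s≤s (s≤s t≤n)
    at : ∀ {x y a b} → toℕ x ≡ a → toℕ y ≡ b → ends n d x y ≡ endsℕ n d a b
    at = cong₂ (endsℕ n d)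
    left-adj : pathAdj n u (vertex t t≤) ≡ true
    left-adj = adj-pred u _ (trans u≡1+t (cong suc (sym (toℕ-vertex t≤))))
    no-source : ¬ IsSource (Path n) (ends n d) u
    no-source source = case trans (sym (source _ left-adj))
                                  (trans (at u≡1+t (toℕ-vertex t≤)) (endsℕ-not-leftward n d t≤n)) of λ ()
    no-sink : endsℕ n d t (suc t) ≡ false ⊎ endsℕ n d (suc (suc t)) (suc t) ≡ false →
              ¬ IsSink (Path n) (ends n d) u
    no-sink (inj₁ none) sink =
      case trans (sym (sink _ left-adj)) (trans (at (toℕ-vertex t≤) u≡1+t) none) of λ ()
    no-sink (inj₂ none) sink =
      case trans (sym (sink _ (adj-succ u _ (trans (toℕ-vertex 2+t≤) (cong suc (sym u≡1+t))))))
                 (trans (at (toℕ-vertex 2+t≤) u≡1+t) none) of λ ()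

module _ (n : ℕ) where
  open PathGraph n

  relℕ-ends : ∀ d {i j} → i ≤ suc (suc n) → j ≤ suc (suc n) → relℕ (ends n d) i j ≡ endsℕ n d i j
  relℕ-ends d i≤ j≤ = trans (relℕ-at (ends n d) (toℕ-vertex i≤) (toℕ-vertex j≤))
                            (cong₂ (endsℕ n d) (toℕ-vertex i≤) (toℕ-vertex j≤))

  ends-marks : ∀ d → EdgeRow.marks (forward (ends n d)) (backward (ends n d)) (suc (suc n)) ≡ 2
  ends-marks d = begin
    sumBelow (suc (suc n)) (λ i → 𝟙 (relℕ (ends n d) i (suc i)) + 𝟙 (relℕ (ends n d) (suc i) i))
      ≡⟨ sumBelow-cong _ (λ i i<2+n → trans (cong₂ (λ p q → 𝟙 p + 𝟙 q)
                                                    (relℕ-ends d (<⇒≤ i<2+n) i<2+n)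
                                                    (relℕ-ends d i<2+n (<⇒≤ i<2+n)))
                                             (endsℕ-edge n d i)) ⟩
    sumBelow (suc (suc n)) (λ i → 𝟙 (i ≡ᵇ 0) + 𝟙 (i ≡ᵇ suc n))
      ≡⟨ sumBelow-distrib-+ (suc (suc n)) _ _ ⟩
    sumBelow (suc (suc n)) (λ i → 𝟙 (i ≡ᵇ 0)) + sumBelow (suc (suc n)) (λ i → 𝟙 (i ≡ᵇ suc n))
      ≡⟨ cong₂ _+_ first-edge last-edge ⟩
    2 ∎
    where
    open ≡-Reasoning
    first-edge : sumBelow (suc (suc n)) (λ i → 𝟙 (i ≡ᵇ 0)) ≡ 1
    first-edge =
      trans (sumBelow-suc (suc n) _) (cong suc (sumBelow-𝟙-vanishing (suc n) _ (λ _ _ → refl)))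
    last-edge : sumBelow (suc (suc n)) (λ i → 𝟙 (i ≡ᵇ suc n)) ≡ 1
    last-edge =
      cong₂ _+_ (sumBelow-𝟙-vanishing (suc n) _ (λ i i<1+n → dec-false (i ≟ suc n) (<⇒≢ i<1+n)))
                (cong 𝟙 (≡ᵇ-refl (suc n)))

  ends-last-edge : ∀ d {Y} → ends n d ⊆ Y → (∀ i → forward Y i ≡ true → backward Y i ≡ false) →
                   EdgeRow.Marked (forward Y) (backward Y) (suc n) × backward Y (suc n) ≡ d
  ends-last-edge false {Y} X⊆Y exclusive = inj₁ forward-arrow , exclusive (suc n) forward-arrow
    where
    forward-arrow : forward Y (suc n) ≡ true
    forward-arrow = relℕ-mono X⊆Y (trans (relℕ-ends false (n≤1+n (suc n)) ≤-refl)
                                         (cong₂ _∧_ (≡ᵇ-refl n) (≡ᵇ-refl n)))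
  ends-last-edge true {Y} X⊆Y _ = inj₂ backward-arrow , backward-arrow
    where
    backward-arrow : backward Y (suc n) ≡ true
    backward-arrow = relℕ-mono X⊆Y (trans (relℕ-ends true ≤-refl (n≤1+n (suc n)))
                                          (cong₂ _∧_ (≡ᵇ-refl n) (≡ᵇ-refl n)))

  ends-moves-parity : ∀ d Y → SelfOrDescendent (Path n) (ends n d) Y → IsTerminal (Path n) Y →
                      parity (diffCard (Path n) Y (ends n d)) ≡ parity (𝟙 d + n)
  ends-moves-parity d Y X↝Y terminal = parity-cancel {D} {G} {n} {𝟙 d} moves+gaps gaps-parity-d
    where
    X⊆Y : ends n d ⊆ Y
    X⊆Y = descendent-⊇ (Path n) X↝Y
    open EdgeRow (forward Y) (backward Y)
    open TerminalPattern (terminal-pattern Y terminal (relℕ-mono X⊆Y (relℕ-ends d z≤n (s≤s z≤n))))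
    D G : ℕ
    D = diffCard (Path n) Y (ends n d)
    G = gaps (suc (suc n))
    gaps-parity-d : parity G ≡ parity (𝟙 d)
    gaps-parity-d with ends-last-edge d X⊆Y exclusive
    ... | last-marked , last≡d = trans (gaps-parity (suc n) ≤-refl last-marked) (cong (parity ∘ 𝟙) last≡d)
    moves+gaps : D + G ≡ n
    moves+gaps = +-cancelˡ-≡ 2 (D + G) n (begin
      2 + (D + G)  ≡⟨ sym (+-assoc 2 D G) ⟩
      (2 + D) + G  ≡⟨ cong (_+ G) (+-comm 2 D) ⟩
      (D + 2) + G  ≡⟨ cong (λ m → (D + m) + G) (sym (ends-marks d)) ⟩
      (D + EdgeRow.marks (forward (ends n d)) (backward (ends n d)) (suc (suc n))) + G
                   ≡⟨ cong (_+ G) (diffCard-on-path X⊆Y (proj₁ (proj₁ terminal))) ⟩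
      marks (suc (suc n)) + G
                   ≡⟨ marks+gaps exclusive (suc (suc n)) ⟩
      2 + n ∎)
      where open ≡-Reasoning

MovesState : ℕ → (G : Graph) → Arrows G → Set
MovesState r G X = IsState G X × (∀ Y → SelfOrDescendent G X Y → IsTerminal G Y → diffCard G Y X % 2 ≡ r)

F-movesState : ∀ n → MovesState (n % 2) (Path n) (F n)
F-movesState n = ends-isState n false (λ ()) , λ Y X↝Y terminal →
  parity⇒%2 (diffCard (Path n) Y (F n)) n (ends-moves-parity n false Y X↝Y terminal)

C-movesState : ∀ n → MovesState (n % 2) (Path (suc n)) (C (suc n))
C-movesState n = ends-isState (suc n) true (λ _ ()) , λ Y X↝Y terminal →
  parity⇒%2 (diffCard (Path (suc n)) Y (C (suc n))) n (ends-moves-parity (suc n) true Y X↝Y terminal)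

mainTheorem11 : (n : ℕ) →
    (n % 2 ≡ 0 → EvenMovesState (Path n) (F n) × EvenMovesState (Path (suc n)) (C (suc n)))
    × (n % 2 ≡ 1 → OddMovesState (Path n) (F n) × OddMovesState (Path (suc n)) (C (suc n)))
mainTheorem11 n = both , both
  where
  both : ∀ {r} → n % 2 ≡ r → MovesState r (Path n) (F n) × MovesState r (Path (suc n)) (C (suc n))
  both refl = F-movesState n , C-movesState n
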